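{- Let $\tilde G,G$ be finite groups and $H\le\tilde H$ finite abelian groups, with a surjective homomorphism $\pi_G:\tilde G\to G$ and the injective inclusion $\iota_H:H\to\tilde H$. Let $k\ge1$. Then for every $\vec x\in\tilde G^k$, $|\ker\tilde\Gamma_{\vec x}|=|\ker\Gamma_{\pi_G(\vec x)}|$; moreover $\gamma_k(\tilde G,\tilde H)=|\ker\pi_G|^k\cdot\gamma_k(G,H)$; $\eta_k(\tilde G,\tilde H)=\eta_k(G,H)$ if $\iota_H$ is an isomorphism and $\eta_k(\tilde G,\tilde H)=1$ otherwise; and for every subset $S\subseteq G^k$, $\Pr_{\vec y\sim G^k}[\vec y\in S]=\Pr_{\vec x\sim\tilde G^k}[\pi_G(\vec x)\in S]$ (uniform distributions), where $\pi_G$ is applied coordinatewise.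
   Context: $\mathrm{LiftHom}(\tilde G,\tilde H)=\{\iota_H\circ\varphi\circ\pi_G:\varphi\in\mathrm{Hom}(G,H)\}$, an abelian group under pointwise operation. For $\vec y\in G^k$, $\Gamma_{\vec y}:\mathrm{Hom}(G,H)\to H^k$, $\varphi\mapsto(\varphi(y_1),\dots,\varphi(y_k))$, with image $\mathsf{H}_{\vec y}$; for $\vec x\in\tilde G^k$, $\tilde\Gamma_{\vec x}:\mathrm{LiftHom}(\tilde G,\tilde H)\to\tilde H^k$, $\psi\mapsto(\psi(x_1),\dots,\psi(x_k))$, with image $\tilde{\mathsf{H}}_{\vec x}$. $\gamma_k(G,H)=\sum_{\vec y\in G^k}|\ker\Gamma_{\vec y}|$ and $\eta_k(G,H)=|\{\vec y\in G^k:\mathsf{H}_{\vec y}\ne H^k\}|/|G|^k$; $\gamma_k(\tilde G,\tilde H)=\sum_{\vec x\in\tilde G^k}|\ker\tilde\Gamma_{\vec x}|$ and $\eta_k(\tilde G,\tilde H)=|\{\vec x\in\tilde G^k:\tilde{\mathsf{H}}_{\vec x}\ne\tilde H^k\}|/|\tilde G|^k$. -}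

module Defs where

open import Level using (Level)
open import Function using (_∘_)
open import Data.Nat using (ℕ; zero; suc; _+_; _^_; NonZero)
open import Data.Nat.Properties using (m^n≢0)
open import Data.Fin using (Fin; _≟_)
open import Data.Fin.Properties using (any?; all?)
open import Data.Vec using (Vec; []; _∷_; lookup; tabulate; map)
open import Data.Vec.Properties using (lookup∘tabulate; map-cong)
open import Data.Vec.Properties using (≡-dec)
open import Data.Product using (Σ; ∃; _×_; _,_; proj₁; proj₂)
open import Data.Integer using (+_)
open import Data.Rational using (ℚ; _/_)
open import Relation.Nullary using (Dec; yes; no; ¬_; ¬?)
open import Relation.Nullary.Decidable using (_×-dec_)
open import Relation.Unary using (Pred; Decidable)
open import Relation.Binary.PropositionalEquality
open import Algebra.Core using (Op₁; Op₂)
open import Algebra.Structures using (IsGroup; IsAbelianGroup)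
import Algebra.Morphism.Definitions as MorphDefs

-- Finite groups: a group whose carrier is Fin order (every finite group
-- is isomorphic to one of this form), with propositional equality.

record FinGroup : Set where
  field
    order   : ℕ
    _∙_     : Op₂ (Fin order)
    ε       : Fin order
    _⁻¹     : Op₁ (Fin order)
    isGroup : IsGroup _≡_ _∙_ ε _⁻¹

  Carrier : Set
  Carrier = Fin order

record FinAbelianGroup : Set where
  field
    order          : ℕ
    _∙_            : Op₂ (Fin order)
    ε              : Fin order
    _⁻¹            : Op₁ (Fin order)
    isAbelianGroup : IsAbelianGroup _≡_ _∙_ ε _⁻¹

  finGroup : FinGroup
  finGroup = record { order = order ; _∙_ = _∙_ ; ε = ε ; _⁻¹ = _⁻¹
                    ; isGroup = IsAbelianGroup.isGroup isAbelianGroup }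

  Carrier : Set
  Carrier = Fin order

open FinGroup using (Carrier; order)

IsHom : (G H : FinGroup) → (Carrier G → Carrier H) → Set
IsHom G H f = MorphDefs.Homomorphic₂ (Carrier G) (Carrier H) _≡_ f (FinGroup._∙_ G) (FinGroup._∙_ H)

sumFin : ∀ {n} → (Fin n → ℕ) → ℕ
sumFin {zero}  f = 0
sumFin {suc n} f = f Fin.zero + sumFin (f ∘ Fin.suc)

sumVec : ∀ {n} k → (Vec (Fin n) k → ℕ) → ℕ
sumVec zero    F = F []
sumVec (suc k) F = sumFin (λ i → sumVec k (λ v → F (i ∷ v)))

-- sum over all maps Fin n → Fin m (each map enumerated once, via its table)
sumFun : ∀ {n m} → ((Fin n → Fin m) → ℕ) → ℕ
sumFun {n} F = sumVec n (λ v → F (lookup v))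

ind : ∀ {ℓ} {P : Set ℓ} → Dec P → ℕ
ind (yes _) = 1
ind (no _)  = 0

anyVec? : ∀ {ℓ m} n {P : Pred (Vec (Fin m) n) ℓ} → Decidable P → Dec (∃ P)
anyVec? zero P? with P? []
... | yes p = yes ([] , p)
... | no ¬p = no λ { ([] , p) → ¬p p }
anyVec? (suc n) {P} P? with any? (λ i → anyVec? n (λ v → P? (i ∷ v)))
... | yes (i , v , p) = yes (i ∷ v , p)
... | no ¬p = no λ { (i ∷ v , p) → ¬p (i , v , p) }

allVec? : ∀ {ℓ m} n {P : Pred (Vec (Fin m) n) ℓ} → Decidable P → Dec (∀ v → P v)
allVec? zero P? with P? []
... | yes p = yes λ { [] → p }
... | no ¬p = no λ f → ¬p (f [])
allVec? (suc n) {P} P? with all? (λ i → allVec? n (λ v → P? (i ∷ v)))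
... | yes f = yes λ { (i ∷ v) → f i v }
... | no ¬f = no λ f → ¬f (λ i v → f (i ∷ v))

Ext : ∀ {ℓ n m} → Pred (Fin n → Fin m) ℓ → Set ℓ
Ext P = ∀ {f g} → (∀ a → f a ≡ g a) → P f → P g

anyFun? : ∀ {ℓ n m} {P : Pred (Fin n → Fin m) ℓ} → Ext P → Decidable P → Dec (∃ P)
anyFun? {n = n} {P = P} ext P? with anyVec? n (λ v → P? (lookup v))
... | yes (v , p) = yes (lookup v , p)
... | no ¬p = no λ { (f , p) → ¬p (tabulate f , ext (λ a → sym (lookup∘tabulate f a)) p) }

isHom? : (G H : FinGroup) (f : Carrier G → Carrier H) → Dec (IsHom G H f)
isHom? G H f = all? λ a → all? λ b → f (FinGroup._∙_ G a b) ≟ FinGroup._∙_ H (f a) (f b)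

isHom-ext : (G H : FinGroup) → Ext (IsHom G H)
isHom-ext G H {f} {g} e h a b =
  trans (sym (e _)) (trans (h a b) (cong₂ (FinGroup._∙_ H) (e a) (e b)))

fin⇒nonZero : ∀ {n} → Fin n → NonZero n
fin⇒nonZero {suc n} _ = _

module _ (G : FinGroup) (H : FinAbelianGroup) where
  private
    H′ = FinAbelianGroup.finGroup H
    εH = FinAbelianGroup.ε H

  InKerΓ : ∀ {k} → Vec (Carrier G) k → Pred (Carrier G → Carrier H′) _
  InKerΓ y φ = IsHom G H′ φ × (∀ i → φ (lookup y i) ≡ εH)

  inKerΓ? : ∀ {k} (y : Vec (Carrier G) k) → Decidable (InKerΓ y)
  inKerΓ? y φ = isHom? G H′ φ ×-dec all? (λ i → φ (lookup y i) ≟ εH)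

  kerΓSize : ∀ {k} → Vec (Carrier G) k → ℕ
  kerΓSize y = sumFun (λ φ → ind (inKerΓ? y φ))

  γ : ℕ → ℕ
  γ k = sumVec k kerΓSize

  ΓFull : ∀ {k} → Vec (Carrier G) k → Set
  ΓFull {k} y = ∀ (h : Vec (Carrier H′) k) → ∃ λ φ → IsHom G H′ φ × map φ y ≡ h

  ΓFull? : ∀ {k} (y : Vec (Carrier G) k) → Dec (ΓFull y)
  ΓFull? {k} y = allVec? k λ h → anyFun?
      (λ {f} {g} e (hf , p) → isHom-ext G H′ e hf , trans (sym (map-cong e y)) p)
      (λ φ → isHom? G H′ φ ×-dec ≡-dec _≟_ (map φ y) h)

  η : ℕ → ℚ
  η k = _/_ (+ sumVec k (λ y → ind (¬? (ΓFull? y))))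
          (order G ^ k) {{m^n≢0 (order G) k {{fin⇒nonZero (FinGroup.ε G)}}}}

module Lifted (G̃ G : FinGroup) (H H̃ : FinAbelianGroup)
              (π : Carrier G̃ → Carrier G)
              (ι : FinAbelianGroup.Carrier H → FinAbelianGroup.Carrier H̃) where
  private
    H′  = FinAbelianGroup.finGroup H
    H̃′ = FinAbelianGroup.finGroup H̃
    εH̃ = FinAbelianGroup.ε H̃

  InLiftHom : Pred (Carrier G̃ → Carrier H̃′) _
  InLiftHom ψ = ∃ λ (φ : Carrier G → Carrier H′) → IsHom G H′ φ × (∀ a → ψ a ≡ ι (φ (π a)))

  inLiftHom? : Decidable InLiftHom
  inLiftHom? ψ = anyFun? (λ {f} {g} e (hf , p) → isHom-ext G H′ e hf , λ a → trans (p a) (cong ι (e (π a))))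
                         (λ φ → isHom? G H′ φ ×-dec all? (λ a → ψ a ≟ ι (φ (π a))))

  InLiftHom-ext : Ext InLiftHom
  InLiftHom-ext e (φ , h , p) = φ , h , λ a → trans (sym (e a)) (p a)

  InKerΓ̃ : ∀ {k} → Vec (Carrier G̃) k → Pred (Carrier G̃ → Carrier H̃′) _
  InKerΓ̃ x ψ = InLiftHom ψ × (∀ i → ψ (lookup x i) ≡ εH̃)

  inKerΓ̃? : ∀ {k} (x : Vec (Carrier G̃) k) → Decidable (InKerΓ̃ x)
  inKerΓ̃? x ψ = inLiftHom? ψ ×-dec all? (λ i → ψ (lookup x i) ≟ εH̃)

  kerΓ̃Size : ∀ {k} → Vec (Carrier G̃) k → ℕ
  kerΓ̃Size x = sumFun (λ ψ → ind (inKerΓ̃? x ψ))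

  γ̃ : ℕ → ℕ
  γ̃ k = sumVec k kerΓ̃Size

  Γ̃Full : ∀ {k} → Vec (Carrier G̃) k → Set
  Γ̃Full {k} x = ∀ (h : Vec (Carrier H̃′) k) → ∃ λ ψ → InLiftHom ψ × map ψ x ≡ h

  Γ̃Full? : ∀ {k} (x : Vec (Carrier G̃) k) → Dec (Γ̃Full x)
  Γ̃Full? {k} x = allVec? k λ h → anyFun?
      (λ {f} {g} e (hf , p) → InLiftHom-ext e hf , trans (sym (map-cong e x)) p)
      (λ ψ → inLiftHom? ψ ×-dec ≡-dec _≟_ (map ψ x) h)

  η̃ : ℕ → ℚ
  η̃ k = _/_ (+ sumVec k (λ x → ind (¬? (Γ̃Full? x))))
          (order G̃ ^ k) {{m^n≢0 (order G̃) k {{fin⇒nonZero (FinGroup.ε G̃)}}}}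

  kerπSize : ℕ
  kerπSize = sumFin (λ a → ind (π a ≟ FinGroup.ε G))

Pr : ∀ {ℓ n} k .{{_ : NonZero n}} (E : Pred (Vec (Fin n) k) ℓ) → Decidable E → ℚ
Pr {n = n} k E E? = _/_ (+ sumVec k (λ v → ind (E? v))) (n ^ k) {{m^n≢0 n k}}

-- Composing with π and ι identifies Hom(G,H) with LiftHom(G̃,H̃), and φ kills π(x) exactly
-- when ι ∘ φ ∘ π kills x, since ι is injective; so the kernels of Γ_{π x} and Γ̃_x are in
-- bijection. Every fibre of π is a coset of ker π, so summing a function of π(x) over G̃^k
-- gives |ker π|^k times the sum over G^k, and |G̃|^k = |ker π|^k |G|^k; this yields the formula
-- for γ and the equality of probabilities. When ι is onto, Γ̃_x is onto iff Γ_{π x} is, so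
-- η̃ = η. Otherwise some y ∈ H̃ lies outside ι(H), and no lifted homomorphism sends x₁ to y, so
-- no Γ̃_x is onto when k ≥ 1.

module Submission where

open import Defs
import Level
open import Level using (0ℓ)
open import Function using (_∘_; id)
open import Data.Nat using (ℕ; zero; suc; _+_; _*_; _^_; _≤_; s≤s; NonZero)
open import Data.Nat.Properties
  using (*-comm; *-assoc; *-zeroʳ; *-identityˡ; *-identityʳ; +-identityʳ; m^n≢0; +-commutativeSemigroup; *-commutativeSemigroup)
import Algebra.Properties.CommutativeSemigroup as CommutativeSemigroupProperties
open import Data.Fin using (Fin; _≟_)
open import Data.Fin.Properties using (suc-injective; any?; all?; ¬∀⟶∃¬)
open import Data.Vec using (Vec; []; _∷_; map; lookup; tabulate; replicate)
open import Data.Vec.Properties using (≡-dec; ∷-injective; ∷-injectiveˡ; lookup∘tabulate; lookup-map; map-∘; map-cong; map-id)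
open import Data.Vec.Relation.Binary.Pointwise.Extensional using (ext; Pointwise-≡⇒≡)
open import Data.Product using (∃; _×_; _,_; proj₁; proj₂; uncurry)
import Data.Integer as ℤ
open import Data.Integer.Properties using (pos-*)
open import Data.Rational using (1ℚ; _/_; fromℚᵘ)
import Data.Rational.Properties as ℚ
import Data.Rational.Unnormalised.Base as ℚᵘ
import Data.Rational.Unnormalised.Properties as ℚᵘ
open import Relation.Nullary using (Dec; yes; no; ¬_; ¬?; contradiction)
open import Relation.Nullary.Decidable using (_×-dec_)
open import Relation.Unary using (Pred; Decidable)
open import Relation.Binary.Definitions using (DecidableEquality)
open import Relation.Binary.PropositionalEquality
open import Algebra.Bundles using (Group)
import Algebra.Properties.Group as GroupProperties
open import Function.Definitions using (Injective; Surjective; Bijective)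

open CommutativeSemigroupProperties +-commutativeSemigroup using () renaming (interchange to +-interchange)
open CommutativeSemigroupProperties *-commutativeSemigroup using () renaming (x∙yz≈yx∙z to *-leftComm)
open FinGroup using (Carrier; order)

ind-yes : ∀ {a} {P : Set a} → P → (p : Dec P) → ind p ≡ 1
ind-yes _ (yes _) = refl
ind-yes p (no ¬p) = contradiction p ¬p

ind-no : ∀ {a} {P : Set a} → ¬ P → (p : Dec P) → ind p ≡ 0
ind-no ¬p (yes p) = contradiction p ¬p
ind-no _  (no _)  = refl

ind-⇔ : ∀ {a b} {P : Set a} {Q : Set b} → (P → Q) → (Q → P) → (p : Dec P) (q : Dec Q) → ind p ≡ ind q
ind-⇔ P⇒Q Q⇒P (yes p) q = sym (ind-yes (P⇒Q p) q)
ind-⇔ P⇒Q Q⇒P (no ¬p) q = sym (ind-no (¬p ∘ Q⇒P) q)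

ind-× : ∀ {a b} {P : Set a} {Q : Set b} (p : Dec P) (q : Dec Q) → ind (p ×-dec q) ≡ ind p * ind q
ind-× (yes _) (yes _) = refl
ind-× (yes _) (no _)  = refl
ind-× (no _)  (yes _) = refl
ind-× (no _)  (no _)  = refl

record Additive (B : Set) : Set where
  field
    sum      : (B → ℕ) → ℕ
    sum-cong : ∀ {f g} → f ≗ g → sum f ≡ sum g
    sum-0    : sum (λ _ → 0) ≡ 0
    sum-+    : ∀ f g → sum (λ b → f b + g b) ≡ sum f + sum g

  sum-*ˡ : ∀ c (f : B → ℕ) → sum (λ b → c * f b) ≡ c * sum f
  sum-*ˡ zero    f = sum-0
  sum-*ˡ (suc c) f = trans (sum-+ f (λ b → c * f b)) (cong (sum f +_) (sum-*ˡ c f))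

  sum-*ʳ : ∀ c (f : B → ℕ) → sum (λ b → f b * c) ≡ sum f * c
  sum-*ʳ c f = trans (sum-cong (λ b → *-comm (f b) c)) (trans (sum-*ˡ c f) (*-comm c (sum f)))

  sum-zeros : ∀ {f} → (∀ b → f b ≡ 0) → sum f ≡ 0
  sum-zeros f≗0 = trans (sum-cong f≗0) sum-0

record FiniteSum (A : Set) : Set₁ where
  field
    additive : Additive A
    _≟ᴬ_     : DecidableEquality A
  open Additive additive public
  field
    sum-swap : ∀ {B} (T : Additive B) (F : A → B → ℕ) →
               sum (λ a → Additive.sum T (F a)) ≡ Additive.sum T (λ b → sum (λ a → F a b))
    sum-δ    : ∀ a → sum (λ x → ind (x ≟ᴬ a)) ≡ 1

  sum-sift : ∀ a (g : A → ℕ) → sum (λ x → ind (x ≟ᴬ a) * g x) ≡ g a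
  sum-sift a g = begin
    sum (λ x → ind (x ≟ᴬ a) * g x) ≡⟨ sum-cong at-a ⟩
    sum (λ x → ind (x ≟ᴬ a) * g a) ≡⟨ sum-*ʳ (g a) _ ⟩
    sum (λ x → ind (x ≟ᴬ a)) * g a ≡⟨ cong (_* g a) (sum-δ a) ⟩
    1 * g a                        ≡⟨ *-identityˡ (g a) ⟩
    g a                            ∎
    where
    open ≡-Reasoning
    at-a : ∀ x → ind (x ≟ᴬ a) * g x ≡ ind (x ≟ᴬ a) * g a
    at-a x with x ≟ᴬ a
    ... | yes refl = refl
    ... | no _     = refl

  sum-ind-unique : ∀ {r q} {R : Pred A r} {Q : Set q} (R? : Decidable R) (Q? : Dec Q) →
                   (∀ {x y} → R x → R y → x ≡ y) → (∃ R → Q) → (Q → ∃ R) →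
                   sum (λ x → ind (R? x)) ≡ ind Q?
  sum-ind-unique R? (yes q) unique _ witness = trans (sum-cong at-a) (sum-δ a)
    where
    a  = proj₁ (witness q)
    Ra = proj₂ (witness q)
    at-a : ∀ x → ind (R? x) ≡ ind (x ≟ᴬ a)
    at-a x = ind-⇔ (λ Rx → unique Rx Ra) (λ { refl → Ra }) (R? x) (x ≟ᴬ a)
  sum-ind-unique R? (no ¬q) _ toQ _ = sum-zeros (λ x → ind-no (λ Rx → ¬q (toQ (x , Rx))) (R? x))

sumFin-cong : ∀ {n} {f g : Fin n → ℕ} → f ≗ g → sumFin f ≡ sumFin g
sumFin-cong {zero}  f≗g = refl
sumFin-cong {suc n} f≗g = cong₂ _+_ (f≗g Fin.zero) (sumFin-cong (f≗g ∘ Fin.suc))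

sumFin-const : ∀ n c → sumFin {n} (λ _ → c) ≡ n * c
sumFin-const zero    c = refl
sumFin-const (suc n) c = cong (c +_) (sumFin-const n c)

sumFin-+ : ∀ {n} (f g : Fin n → ℕ) → sumFin (λ i → f i + g i) ≡ sumFin f + sumFin g
sumFin-+ {zero}  f g = refl
sumFin-+ {suc n} f g = trans (cong (f Fin.zero + g Fin.zero +_) (sumFin-+ (f ∘ Fin.suc) (g ∘ Fin.suc)))
                             (+-interchange (f Fin.zero) (g Fin.zero) _ _)

sumFin-additive : ∀ n → Additive (Fin n)
sumFin-additive n = record
  { sum      = sumFin
  ; sum-cong = sumFin-cong
  ; sum-0    = trans (sumFin-const n 0) (*-zeroʳ n)
  ; sum-+    = sumFin-+
  }

sumFin-swap : ∀ {n B} (T : Additive B) (F : Fin n → B → ℕ) →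
              sumFin (λ a → Additive.sum T (F a)) ≡ Additive.sum T (λ b → sumFin (λ a → F a b))
sumFin-swap {zero}  T F = sym (Additive.sum-0 T)
sumFin-swap {suc n} T F = trans (cong (Additive.sum T (F Fin.zero) +_) (sumFin-swap T (F ∘ Fin.suc)))
                                (sym (Additive.sum-+ T (F Fin.zero) _))

sumFin-δ : ∀ {n} (a : Fin n) → sumFin (λ x → ind (x ≟ a)) ≡ 1
sumFin-δ {suc n} Fin.zero    = cong suc (Additive.sum-0 (sumFin-additive n))
sumFin-δ {suc n} (Fin.suc a) = trans (sumFin-cong (λ x → ind-⇔ suc-injective (cong Fin.suc) (Fin.suc x ≟ Fin.suc a) (x ≟ a)))
                                     (sumFin-δ a)

Fin-finiteSum : ∀ n → FiniteSum (Fin n)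
Fin-finiteSum n = record
  { additive = sumFin-additive n
  ; _≟ᴬ_     = _≟_
  ; sum-swap = sumFin-swap
  ; sum-δ    = sumFin-δ
  }

module _ {n : ℕ} where
  private
    module ΣFin = FiniteSum (Fin-finiteSum n)

  sumVec-cong : ∀ k {f g : Vec (Fin n) k → ℕ} → f ≗ g → sumVec k f ≡ sumVec k g
  sumVec-cong zero    f≗g = f≗g []
  sumVec-cong (suc k) f≗g = sumFin-cong {n} (λ i → sumVec-cong k (λ v → f≗g (i ∷ v)))

  sumVec-+ : ∀ k (f g : Vec (Fin n) k → ℕ) → sumVec k (λ v → f v + g v) ≡ sumVec k f + sumVec k g
  sumVec-+ zero    f g = refl
  sumVec-+ (suc k) f g = trans (sumFin-cong {n} (λ i → sumVec-+ k _ _)) (sumFin-+ {n} _ _)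

  sumVec-const : ∀ k c → sumVec {n} k (λ _ → c) ≡ n ^ k * c
  sumVec-const zero    c = sym (*-identityˡ c)
  sumVec-const (suc k) c = trans (sumFin-cong {n} (λ _ → sumVec-const k c))
                                 (trans (sumFin-const n (n ^ k * c)) (sym (*-assoc n (n ^ k) c)))

  sumVec-1 : ∀ k → sumVec {n} k (λ _ → 1) ≡ n ^ k
  sumVec-1 k = trans (sumVec-const k 1) (*-identityʳ (n ^ k))

  sumVec-additive : ∀ k → Additive (Vec (Fin n) k)
  sumVec-additive k = record
    { sum      = sumVec k
    ; sum-cong = sumVec-cong k
    ; sum-0    = trans (sumVec-const k 0) (*-zeroʳ (n ^ k))
    ; sum-+    = sumVec-+ k
    }

  sumVec-swap : ∀ k {B} (T : Additive B) (F : Vec (Fin n) k → B → ℕ) →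
                sumVec k (λ v → Additive.sum T (F v)) ≡ Additive.sum T (λ b → sumVec k (λ v → F v b))
  sumVec-swap zero    T F = refl
  sumVec-swap (suc k) T F = trans (sumFin-cong {n} (λ i → sumVec-swap k T (λ v → F (i ∷ v))))
                                  (sumFin-swap T (λ i b → sumVec k (λ v → F (i ∷ v) b)))

  sumVec-δ : ∀ k (w : Vec (Fin n) k) → sumVec k (λ v → ind (≡-dec _≟_ v w)) ≡ 1
  sumVec-δ zero    []      = refl
  sumVec-δ (suc k) (b ∷ w) = begin
    sumFin (λ i → sumVec k (λ v → ind (≡-dec _≟_ (i ∷ v) (b ∷ w))))
      ≡⟨ sumFin-cong {n} (λ i → sumVec-cong k (ind-∷ i)) ⟩
    sumFin (λ i → sumVec k (λ v → ind (i ≟ b) * ind (≡-dec _≟_ v w)))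
      ≡⟨ sumFin-cong {n} (λ i → Additive.sum-*ˡ (sumVec-additive k) (ind (i ≟ b)) _) ⟩
    sumFin (λ i → ind (i ≟ b) * sumVec k (λ v → ind (≡-dec _≟_ v w)))
      ≡⟨ ΣFin.sum-sift b _ ⟩
    sumVec k (λ v → ind (≡-dec _≟_ v w))
      ≡⟨ sumVec-δ k w ⟩
    1 ∎
    where
    open ≡-Reasoning
    ind-∷ : ∀ i v → ind (≡-dec _≟_ (i ∷ v) (b ∷ w)) ≡ ind (i ≟ b) * ind (≡-dec _≟_ v w)
    ind-∷ i v = trans (ind-⇔ ∷-injective (uncurry (cong₂ _∷_)) (≡-dec _≟_ (i ∷ v) (b ∷ w)) (i ≟ b ×-dec ≡-dec _≟_ v w))
                      (ind-× (i ≟ b) (≡-dec _≟_ v w))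

  Vec-finiteSum : ∀ k → FiniteSum (Vec (Fin n) k)
  Vec-finiteSum k = record
    { additive = sumVec-additive k
    ; _≟ᴬ_     = ≡-dec _≟_
    ; sum-swap = sumVec-swap k
    ; sum-δ    = sumVec-δ k
    }

module _ {A B : Set} (ΣA : FiniteSum A) (ΣB : FiniteSum B) where
  private
    module A = FiniteSum ΣA
    module B = FiniteSum ΣB

  count-bijection : ∀ {p q} {P : Pred A p} {Q : Pred B q} (P? : Decidable P) (Q? : Decidable Q) (f : A → B) →
                    (∀ {a} → P a → Q (f a)) →
                    (∀ {a a′} → P a → P a′ → f a ≡ f a′ → a ≡ a′) →
                    (∀ {b} → Q b → ∃ λ a → P a × f a ≡ b) →
                    A.sum (λ a → ind (P? a)) ≡ B.sum (λ b → ind (Q? b))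
  count-bijection {Q = Q} P? Q? f f-preserves f-injective f-onto = begin
    A.sum (λ a → ind (P? a))
      ≡⟨ A.sum-cong (λ a → sym (B.sum-sift (f a) (λ _ → ind (P? a)))) ⟩
    A.sum (λ a → B.sum (λ b → ind (b B.≟ᴬ f a) * ind (P? a)))
      ≡⟨ A.sum-swap B.additive _ ⟩
    B.sum (λ b → A.sum (λ a → ind (b B.≟ᴬ f a) * ind (P? a)))
      ≡⟨ B.sum-cong fibre ⟩
    B.sum (λ b → ind (Q? b)) ∎
    where
    open ≡-Reasoning
    fibre : ∀ b → A.sum (λ a → ind (b B.≟ᴬ f a) * ind (P? a)) ≡ ind (Q? b)
    fibre b = trans (A.sum-cong (λ a → sym (ind-× (b B.≟ᴬ f a) (P? a))))
      (A.sum-ind-unique (λ a → b B.≟ᴬ f a ×-dec P? a) (Q? b)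
        (λ (b≡fa , Pa) (b≡fa′ , Pa′) → f-injective Pa Pa′ (trans (sym b≡fa) b≡fa′))
        (λ (a , b≡fa , Pa) → subst Q (sym b≡fa) (f-preserves Pa))
        (λ Qb → let (a , Pa , fa≡b) = f-onto Qb in a , sym fa≡b , Pa))

module _ {n m n′ m′ : ℕ} where
  sumFun-bijection : ∀ {p q} {P : Pred (Fin n → Fin m) p} {Q : Pred (Fin n′ → Fin m′) q}
                     (P? : Decidable P) (Q? : Decidable Q) → Ext P → Ext Q →
                     (L : (Fin n → Fin m) → Fin n′ → Fin m′) →
                     (∀ {φ φ′} → φ ≗ φ′ → L φ ≗ L φ′) →
                     (∀ {φ} → P φ → Q (L φ)) →
                     (∀ {φ φ′} → L φ ≗ L φ′ → φ ≗ φ′) →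
                     (∀ {ψ} → Q ψ → ∃ λ φ → P φ × L φ ≗ ψ) →
                     sumFun (λ φ → ind (P? φ)) ≡ sumFun (λ ψ → ind (Q? ψ))
  sumFun-bijection P? Q? P-ext Q-ext L L-cong L-preserves L-injective L-onto =
    count-bijection (Vec-finiteSum n) (Vec-finiteSum n′) (P? ∘ lookup) (Q? ∘ lookup) table
      (λ {v} Pv → Q-ext (λ a → sym (lookup-table v a)) (L-preserves Pv))
      (λ {v} {v′} _ _ e → Pointwise-≡⇒≡ (ext (L-injective (λ a →
        trans (sym (lookup-table v a)) (trans (cong (λ t → lookup t a) e) (lookup-table v′ a))))))
      (λ Qw → let (φ , Pφ , Lφ≗ψ) = L-onto Qw in
        tabulate φ , P-ext (λ a → sym (lookup∘tabulate φ a)) Pφ ,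
        Pointwise-≡⇒≡ (ext λ a → trans (lookup-table (tabulate φ) a) (trans (L-cong (lookup∘tabulate φ) a) (Lφ≗ψ a))))
    where
    table : Vec (Fin m) n → Vec (Fin m′) n′
    table v = tabulate (L (lookup v))
    lookup-table : ∀ v → lookup (table v) ≗ L (lookup v)
    lookup-table v = lookup∘tabulate (L (lookup v))

/≡fromℚᵘ : ∀ i n .{{_ : NonZero n}} → i / n ≡ fromℚᵘ (i ℚᵘ./ n)
/≡fromℚᵘ i (suc n) = refl

*-cancelˡ-/ : ∀ c a b .{{_ : NonZero b}} .{{_ : NonZero (c * b)}} → ℤ.+ (c * a) / (c * b) ≡ ℤ.+ a / b
*-cancelˡ-/ c a b = begin
  ℤ.+ (c * a) / (c * b)              ≡⟨ ℚ./-cong {ℤ.+ (c * a)} {c * b} {ℤ.+ c ℤ.* ℤ.+ a} (pos-* c a) refl ⟩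
  (ℤ.+ c ℤ.* ℤ.+ a) / (c * b)        ≡⟨ /≡fromℚᵘ (ℤ.+ c ℤ.* ℤ.+ a) (c * b) ⟩
  fromℚᵘ ((ℤ.+ c ℤ.* ℤ.+ a) ℚᵘ./ (c * b)) ≡⟨ ℚ.fromℚᵘ-cong (ℚᵘ.*-cancelˡ-/ c {ℤ.+ a} {b}) ⟩
  fromℚᵘ (ℤ.+ a ℚᵘ./ b)              ≡⟨ /≡fromℚᵘ (ℤ.+ a) b ⟨
  ℤ.+ a / b                          ∎
  where open ≡-Reasoning

/-scale : ∀ c {a a′ b b′} .{{_ : NonZero b}} .{{_ : NonZero b′}} →
          a′ ≡ c * a → b′ ≡ c * b → ℤ.+ a′ / b′ ≡ ℤ.+ a / b
/-scale c {a} {b = b} refl refl = *-cancelˡ-/ c a b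

module _ {n : ℕ} .{{_ : NonZero n}} where
  Pr-cong : ∀ {ℓ₁ ℓ₂} k {E : Pred (Vec (Fin n) k) ℓ₁} {F : Pred (Vec (Fin n) k) ℓ₂}
            (E? : Decidable E) (F? : Decidable F) → (∀ {v} → E v → F v) → (∀ {v} → F v → E v) →
            Pr k E E? ≡ Pr k F F?
  Pr-cong k E? F? E⇒F F⇒E =
    cong (λ s → _/_ (ℤ.+ s) (n ^ k) {{m^n≢0 n k}}) (sumVec-cong k (λ v → ind-⇔ E⇒F F⇒E (E? v) (F? v)))

  Pr-certain : ∀ {ℓ} k {E : Pred (Vec (Fin n) k) ℓ} (E? : Decidable E) → (∀ v → E v) → Pr k E E? ≡ 1ℚ
  Pr-certain k E? always = begin
    _/_ (ℤ.+ sumVec k (λ v → ind (E? v))) (n ^ k) {{m^n≢0 n k}}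
      ≡⟨ cong (λ s → _/_ (ℤ.+ s) (n ^ k) {{m^n≢0 n k}}) (sumVec-cong k (λ v → ind-yes (always v) (E? v))) ⟩
    _/_ (ℤ.+ sumVec k (λ _ → 1)) (n ^ k) {{m^n≢0 n k}}
      ≡⟨ /-scale (n ^ k) {{_}} {{m^n≢0 n k}} (sumVec-const k 1) (sym (*-identityʳ (n ^ k))) ⟩
    1ℚ ∎
    where open ≡-Reasoning

map-injective : ∀ {A B : Set} {f : A → B} {n} → Injective _≡_ _≡_ f → Injective _≡_ _≡_ (map {n = n} f)
map-injective f-injective {[]}     {[]}     _ = refl
map-injective f-injective {x ∷ xs} {y ∷ ys} e =
  let (fx≡fy , fxs≡fys) = ∷-injective e in cong₂ _∷_ (f-injective fx≡fy) (map-injective f-injective fxs≡fys)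

group : FinGroup → Group 0ℓ 0ℓ
group G = record
  { Carrier = Carrier G
  ; _≈_     = _≡_
  ; _∙_     = FinGroup._∙_ G
  ; ε       = FinGroup.ε G
  ; _⁻¹     = FinGroup._⁻¹ G
  ; isGroup = FinGroup.isGroup G
  }

IsHom-ε : ∀ G H {f} → IsHom G H f → f (FinGroup.ε G) ≡ FinGroup.ε H
IsHom-ε G H {f} f-hom = ∙-cancelˡ (f G.ε) (f G.ε) H.ε (begin
  f G.ε H.∙ f G.ε  ≡⟨ f-hom G.ε G.ε ⟨
  f (G.ε G.∙ G.ε)  ≡⟨ cong f (G.identityˡ G.ε) ⟩
  f G.ε            ≡⟨ H.identityʳ (f G.ε) ⟨
  f G.ε H.∙ H.ε    ∎)
  where
  module G = Group (group G)
  module H = Group (group H)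
  open GroupProperties (group H) using (∙-cancelˡ)
  open ≡-Reasoning

module Fibres (G̃ G : FinGroup) (π : Carrier G̃ → Carrier G) (π-hom : IsHom G̃ G π)
              (π-onto : Surjective _≡_ _≡_ π) where
  private
    module G̃ = Group (group G̃)
    module G = Group (group G)
    module ΣG̃ = FiniteSum (Fin-finiteSum (order G̃))
    module ΣG = FiniteSum (Fin-finiteSum (order G))
    open GroupProperties (group G̃) using (\\-leftDividesˡ) renaming (∙-cancelˡ to G̃-cancelˡ)
    open GroupProperties (group G) using () renaming (∙-cancelˡ to G-cancelˡ)
    instance
      G̃-nonZero : NonZero (order G̃)
      G̃-nonZero = fin⇒nonZero G̃.ε
      G-nonZero : NonZero (order G)
      G-nonZero = fin⇒nonZero G.ε

  section : Carrier G → Carrier G̃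
  section b = proj₁ (π-onto b)

  π∘section : ∀ b → π (section b) ≡ b
  π∘section b = proj₂ (π-onto b) refl

  kerSize : ℕ
  kerSize = sumFin (λ a → ind (π a ≟ G.ε))

  -- Left translation by a preimage of b carries ker π onto the fibre over b.
  fibre-size : ∀ b → sumFin (λ a → ind (b ≟ π a)) ≡ kerSize
  fibre-size b = sym (count-bijection (Fin-finiteSum _) (Fin-finiteSum _)
    (λ a → π a ≟ G.ε) (λ a → b ≟ π a) (a₀ G̃.∙_) into-fibre (λ _ _ → G̃-cancelˡ a₀ _ _) onto-fibre)
    where
    open ≡-Reasoning
    a₀ : Carrier G̃
    a₀ = section b
    into-fibre : ∀ {a} → π a ≡ G.ε → b ≡ π (a₀ G̃.∙ a)
    into-fibre {a} πa≡ε = sym (begin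
      π (a₀ G̃.∙ a)     ≡⟨ π-hom a₀ a ⟩
      π a₀ G.∙ π a     ≡⟨ cong₂ G._∙_ (π∘section b) πa≡ε ⟩
      b G.∙ G.ε        ≡⟨ G.identityʳ b ⟩
      b                ∎)
    onto-fibre : ∀ {a′} → b ≡ π a′ → ∃ λ a → π a ≡ G.ε × a₀ G̃.∙ a ≡ a′
    onto-fibre {a′} b≡πa′ = a₀ G̃.\\ a′ , G-cancelˡ (π a₀) _ _ (begin
      π a₀ G.∙ π (a₀ G̃.\\ a′) ≡⟨ π-hom a₀ _ ⟨
      π (a₀ G̃.∙ (a₀ G̃.\\ a′)) ≡⟨ cong π (\\-leftDividesˡ a₀ a′) ⟩
      π a′                     ≡⟨ trans (sym b≡πa′) (sym (π∘section b)) ⟩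
      π a₀                     ≡⟨ G.identityʳ (π a₀) ⟨
      π a₀ G.∙ G.ε             ∎) , \\-leftDividesˡ a₀ a′

  sumFin-∘π : ∀ (f : Carrier G → ℕ) → sumFin (f ∘ π) ≡ kerSize * sumFin f
  sumFin-∘π f = begin
    sumFin (f ∘ π)
      ≡⟨ ΣG̃.sum-cong (λ a → sym (ΣG.sum-sift (π a) f)) ⟩
    sumFin (λ a → sumFin (λ b → ind (b ≟ π a) * f b))
      ≡⟨ ΣG̃.sum-swap ΣG.additive _ ⟩
    sumFin (λ b → sumFin (λ a → ind (b ≟ π a) * f b))
      ≡⟨ ΣG.sum-cong (λ b → trans (ΣG̃.sum-*ʳ (f b) _) (cong (_* f b) (fibre-size b))) ⟩
    sumFin (λ b → kerSize * f b)
      ≡⟨ ΣG.sum-*ˡ kerSize f ⟩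
    kerSize * sumFin f ∎
    where open ≡-Reasoning

  sumVec-map-π : ∀ k (F : Vec (Carrier G) k → ℕ) → sumVec k (F ∘ map π) ≡ kerSize ^ k * sumVec k F
  sumVec-map-π zero    F = sym (+-identityʳ (F []))
  sumVec-map-π (suc k) F = begin
    sumFin (λ a → sumVec k (λ v → F (π a ∷ map π v)))
      ≡⟨ ΣG̃.sum-cong (λ a → sumVec-map-π k (λ w → F (π a ∷ w))) ⟩
    sumFin (λ a → kerSize ^ k * tailSum (π a))
      ≡⟨ ΣG̃.sum-*ˡ (kerSize ^ k) (tailSum ∘ π) ⟩
    kerSize ^ k * sumFin (tailSum ∘ π)
      ≡⟨ cong (kerSize ^ k *_) (sumFin-∘π tailSum) ⟩
    kerSize ^ k * (kerSize * sumFin tailSum)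
      ≡⟨ *-leftComm (kerSize ^ k) kerSize (sumFin tailSum) ⟩
    kerSize * kerSize ^ k * sumFin tailSum ∎
    where
    open ≡-Reasoning
    tailSum : Carrier G → ℕ
    tailSum b = sumVec k (λ w → F (b ∷ w))

  order-^ : ∀ k → order G̃ ^ k ≡ kerSize ^ k * order G ^ k
  order-^ k = begin
    order G̃ ^ k                      ≡⟨ sumVec-1 k ⟨
    sumVec k (λ _ → 1)               ≡⟨ sumVec-map-π k (λ _ → 1) ⟩
    kerSize ^ k * sumVec k (λ _ → 1) ≡⟨ cong (kerSize ^ k *_) (sumVec-1 k) ⟩
    kerSize ^ k * order G ^ k        ∎
    where open ≡-Reasoning

  Pr-map-π : ∀ {ℓ} k (S : Pred (Vec (Carrier G) k) ℓ) (S? : Decidable S) →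
             Pr k S S? ≡ Pr k (S ∘ map π) (S? ∘ map π)
  Pr-map-π k S S? = sym (/-scale (kerSize ^ k) {{m^n≢0 (order G) k}} {{m^n≢0 (order G̃) k}}
                                 (sumVec-map-π k (λ y → ind (S? y))) (order-^ k))

module Lifting (G̃ G : FinGroup) (H H̃ : FinAbelianGroup)
               (π : Carrier G̃ → Carrier G) (π-hom : IsHom G̃ G π) (π-onto : Surjective _≡_ _≡_ π)
               (ι : FinAbelianGroup.Carrier H → FinAbelianGroup.Carrier H̃)
               (ι-hom : IsHom (FinAbelianGroup.finGroup H) (FinAbelianGroup.finGroup H̃) ι)
               (ι-injective : Injective _≡_ _≡_ ι) where
  private
    H′ H̃′ : FinGroup
    H′ = FinAbelianGroup.finGroup H
    H̃′ = FinAbelianGroup.finGroup H̃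
    εH : FinAbelianGroup.Carrier H
    εH = FinAbelianGroup.ε H
    εH̃ : FinAbelianGroup.Carrier H̃
    εH̃ = FinAbelianGroup.ε H̃
  open Lifted G̃ G H H̃ π ι
  open Fibres G̃ G π π-hom π-onto using (section; π∘section)

  ι-ε : ι εH ≡ εH̃
  ι-ε = IsHom-ε H′ H̃′ ι-hom

  lift : (Carrier G → Carrier H′) → Carrier G̃ → Carrier H̃′
  lift φ = ι ∘ φ ∘ π

  map-lift : ∀ {k} φ (x : Vec (Carrier G̃) k) → map (lift φ) x ≡ map ι (map φ (map π x))
  map-lift φ x = trans (map-∘ ι (φ ∘ π) x) (cong (map ι) (map-∘ φ π x))

  lift-injective : ∀ {φ φ′} → lift φ ≗ lift φ′ → φ ≗ φ′
  lift-injective {φ} {φ′} e b = subst (λ c → φ c ≡ φ′ c) (π∘section b) (ι-injective (e (section b)))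

  InKerΓ-ext : ∀ {k} (y : Vec (Carrier G) k) → Ext (InKerΓ G H y)
  InKerΓ-ext y φ≗φ′ (φ-hom , φ-kills) = isHom-ext G H′ φ≗φ′ φ-hom , λ i → trans (sym (φ≗φ′ _)) (φ-kills i)

  InKerΓ̃-ext : ∀ {k} (x : Vec (Carrier G̃) k) → Ext (InKerΓ̃ x)
  InKerΓ̃-ext x ψ≗ψ′ (ψ-lift , ψ-kills) = InLiftHom-ext ψ≗ψ′ ψ-lift , λ i → trans (sym (ψ≗ψ′ _)) (ψ-kills i)

  lift-inKerΓ̃ : ∀ {k} (x : Vec (Carrier G̃) k) {φ} → InKerΓ G H (map π x) φ → InKerΓ̃ x (lift φ)
  lift-inKerΓ̃ x {φ} (φ-hom , φ-kills) =
    (φ , φ-hom , λ _ → refl) , λ i → trans (cong ι (trans (cong φ (sym (lookup-map i π x))) (φ-kills i))) ι-ε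

  inKerΓ̃⇒lift : ∀ {k} (x : Vec (Carrier G̃) k) {ψ} → InKerΓ̃ x ψ → ∃ λ φ → InKerΓ G H (map π x) φ × lift φ ≗ ψ
  inKerΓ̃⇒lift x {ψ} ((φ , φ-hom , ψ≗lift) , ψ-kills) = φ , (φ-hom , φ-kills) , λ a → sym (ψ≗lift a)
    where
    open ≡-Reasoning
    φ-kills : ∀ i → φ (lookup (map π x) i) ≡ εH
    φ-kills i = ι-injective (begin
      ι (φ (lookup (map π x) i)) ≡⟨ cong (ι ∘ φ) (lookup-map i π x) ⟩
      lift φ (lookup x i)        ≡⟨ ψ≗lift (lookup x i) ⟨
      ψ (lookup x i)             ≡⟨ ψ-kills i ⟩
      εH̃                         ≡⟨ ι-ε ⟨
      ι εH                       ∎)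

  kerΓ̃Size≡kerΓSize : ∀ {k} (x : Vec (Carrier G̃) k) → kerΓ̃Size x ≡ kerΓSize G H (map π x)
  kerΓ̃Size≡kerΓSize x = sym (sumFun-bijection (inKerΓ? G H (map π x)) (inKerΓ̃? x)
    (InKerΓ-ext (map π x)) (InKerΓ̃-ext x) lift (λ φ≗φ′ a → cong ι (φ≗φ′ (π a)))
    (lift-inKerΓ̃ x) lift-injective (inKerΓ̃⇒lift x))

  Γ̃Full⇒ΓFull : ∀ {k} (x : Vec (Carrier G̃) k) → Γ̃Full x → ΓFull G H (map π x)
  Γ̃Full⇒ΓFull x full h =
    let (ψ , (φ , φ-hom , ψ≗lift) , ψx≡ιh) = full (map ι h) in
    φ , φ-hom , map-injective ι-injective (begin
      map ι (map φ (map π x)) ≡⟨ map-lift φ x ⟨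
      map (lift φ) x          ≡⟨ map-cong ψ≗lift x ⟨
      map ψ x                 ≡⟨ ψx≡ιh ⟩
      map ι h                 ∎)
    where open ≡-Reasoning

  ΓFull⇒Γ̃Full : Surjective _≡_ _≡_ ι → ∀ {k} (x : Vec (Carrier G̃) k) → ΓFull G H (map π x) → Γ̃Full x
  ΓFull⇒Γ̃Full ι-onto x full h̃ =
    let (φ , φ-hom , φπx≡σh̃) = full (map σ h̃) in
    lift φ , (φ , φ-hom , λ _ → refl) , (begin
      map (lift φ) x          ≡⟨ map-lift φ x ⟩
      map ι (map φ (map π x)) ≡⟨ cong (map ι) φπx≡σh̃ ⟩
      map ι (map σ h̃)        ≡⟨ map-∘ ι σ h̃ ⟨
      map (ι ∘ σ) h̃          ≡⟨ map-cong (λ y → proj₂ (ι-onto y) refl) h̃ ⟩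
      map id h̃               ≡⟨ map-id h̃ ⟩
      h̃                      ∎)
    where
    open ≡-Reasoning
    σ : FinAbelianGroup.Carrier H̃ → FinAbelianGroup.Carrier H
    σ y = proj₁ (ι-onto y)

  ¬bijective⇒missed : ¬ Bijective _≡_ _≡_ ι → ∃ λ y → ∀ h → ι h ≢ y
  ¬bijective⇒missed ¬bij with all? (λ y → any? (λ h → ι h ≟ y))
  ... | yes hit = contradiction ((λ {_} {_} → ι-injective) , λ y → proj₁ (hit y) , λ { refl → proj₂ (hit y) }) ¬bij
  ... | no ¬hit = let (y , y∉ι) = ¬∀⟶∃¬ _ _ (λ y → any? (λ h → ι h ≟ y)) ¬hit in
                  y , λ h ιh≡y → y∉ι (h , ιh≡y)

  ¬Γ̃Full : ¬ Bijective _≡_ _≡_ ι → ∀ {k} → 1 ≤ k → (x : Vec (Carrier G̃) k) → ¬ Γ̃Full x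
  ¬Γ̃Full ¬bij (s≤s _) (x₀ ∷ _) full =
    let (y , y∉ι) = ¬bijective⇒missed ¬bij
        (_ , (φ , _ , ψ≗lift) , ψx≡y∷ε) = full (y ∷ replicate _ εH̃) in
    y∉ι (φ (π x₀)) (trans (sym (ψ≗lift x₀)) (∷-injectiveˡ ψx≡y∷ε))

-- η and η̃ unfold to Pr of the event that Γ (resp. Γ̃) is not onto.
lemma6p3 : (G̃ G : FinGroup) (H H̃ : FinAbelianGroup)
    (π : FinGroup.Carrier G̃ → FinGroup.Carrier G) → IsHom G̃ G π → Surjective _≡_ _≡_ π →
    (ι : FinAbelianGroup.Carrier H → FinAbelianGroup.Carrier H̃) →
    IsHom (FinAbelianGroup.finGroup H) (FinAbelianGroup.finGroup H̃) ι → Injective _≡_ _≡_ ι →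
    (k : ℕ) → 1 ≤ k →
    ((x : Vec (FinGroup.Carrier G̃) k) →
        Lifted.kerΓ̃Size G̃ G H H̃ π ι x ≡ kerΓSize G H (map π x))
    × Lifted.γ̃ G̃ G H H̃ π ι k ≡ Lifted.kerπSize G̃ G H H̃ π ι ^ k * γ G H k
    × (Bijective _≡_ _≡_ ι → Lifted.η̃ G̃ G H H̃ π ι k ≡ η G H k)
    × (¬ Bijective _≡_ _≡_ ι → Lifted.η̃ G̃ G H H̃ π ι k ≡ 1ℚ)
    × ((S : Pred (Vec (FinGroup.Carrier G) k) Level.zero) (S? : Decidable S) →
        Pr k {{fin⇒nonZero (FinGroup.ε G)}} S S?
          ≡ Pr k {{fin⇒nonZero (FinGroup.ε G̃)}} (λ x → S (map π x)) (λ x → S? (map π x)))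
lemma6p3 G̃ G H H̃ π π-hom π-onto ι ι-hom ι-injective k 1≤k =
    kerΓ̃Size≡kerΓSize
  , trans (sumVec-cong k kerΓ̃Size≡kerΓSize) (sumVec-map-π k (kerΓSize G H))
  , (λ (_ , ι-onto) → trans
      (Pr-cong {{G̃≢0}} k (λ x → ¬? (Γ̃Full? x)) (λ x → ¬? (ΓFull? G H (map π x)))
               (_∘ ΓFull⇒Γ̃Full ι-onto _) (_∘ Γ̃Full⇒ΓFull _))
      (sym (Pr-map-π k _ (λ y → ¬? (ΓFull? G H y)))))
  , (λ ¬bij → Pr-certain {{G̃≢0}} k (λ x → ¬? (Γ̃Full? x)) (¬Γ̃Full ¬bij 1≤k))
  , Pr-map-π k
  where
  open Lifted G̃ G H H̃ π ι
  open Fibres G̃ G π π-hom π-onto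
  open Lifting G̃ G H H̃ π π-hom π-onto ι ι-hom ι-injective
  G̃≢0 : NonZero (order G̃)
  G̃≢0 = fin⇒nonZero (FinGroup.ε G̃)
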